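{- A banana tree $\mathcal B$ that satisfies Invariants 1 and 3 also satisfies Conditions III.1 and III.2.
   Context: A banana tree on a set of items (integer positions with distinct real values $f$) consists of bananas: each banana is spanned by a minimum $p$ (lower end) and a maximum $q$ (upper end) with $f(p)<f(q)$ and consists of two trails, the in-trail and the mid-trail, each a sequence of nodes from $p$ to $q$; every maximum other than the special root is an interior node of exactly one trail of another banana. Pointers: for a maximum $q$ interior to a trail, $\mathrm{up}(q)$ and $\mathrm{dn}(q)$ are its neighbours above and below on that trail; $\mathrm{in}(q)$ and $\mathrm{mid}(q)$ are the first nodes below $q$ on the in-trail and mid-trail of the banana with upper end $q$; $\mathrm{birth}(q)$ is its lower end. A node $p$ is an ancestor of an internal node $q$ if $p$ is reached from $q$ by a sequence of $\mathrm{up}$ pointers, and of a leaf $r$ if reached from $\mathrm{in}(r)$ or $\mathrm{mid}(r)$ that way; descendant is the converse. The banana subtree rooted at a maximum $q$ consists of the banana spanned by $\mathrm{birth}(q)$ and $q$ and all bananas whose maximum has an ancestor other than $q$ on the in- or mid-trail of that banana. Invariant 1: for each maximum $q$ except the special root, if $\mathrm{birth}(q)<q$ then all nodes $u\ne q$ of the banana subtree rooted at $q$ satisfy $u<q$ and all descendants $v$ of $\mathrm{dn}(q)$, including $\mathrm{dn}(q)$, satisfy $v>q$; if $\mathrm{birth}(q)>q$ the same with all inequalities reversed. Invariant 3: for each maximum $q$ except the special root, (1) $f(\mathrm{up}(q))>f(q)>f(\mathrm{dn}(q))$; (2) if $q\neq \mathrm{in}(\mathrm{up}(q))$ then $\mathrm{up}(q)<q<\mathrm{dn}(q)$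 or $\mathrm{dn}(q)<q<\mathrm{up}(q)$; (3) if $q=\mathrm{in}(\mathrm{up}(q))$ then either both $\mathrm{up}(q)<q$ and $\mathrm{dn}(q)<q$, or both $\mathrm{up}(q)>q$ and $\mathrm{dn}(q)>q$. Condition III.1 (for a banana with $p<q$): if $p=u_0,\dots,u_j=q$ are the nodes of the in-trail then $u_i>u_{i+1}$ for $0\le i\le j-2$ and $f(u_i)<f(u_{i+1})$ for $0\le i\le j-1$. Condition III.2 (for $p<q$): if $p=v_0,\dots,v_k=q$ are the nodes of the mid-trail then $v_i<v_{i+1}$ and $f(v_i)<f(v_{i+1})$ for $0\le i\le k-1$. Symmetric conditions (with position inequalities reversed) for $p>q$. -}

module Defs where

open import Level using (Level; _⊔_)
open import Data.Integer using (ℤ; _<_; _>_)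
open import Data.List using (List; []; _∷_; _++_; [_])
open import Data.List.Membership.Propositional using (_∈_)
open import Data.List.Relation.Unary.Linked using (Linked)
open import Data.Product using (Σ; ∃; ∃-syntax; _×_; _,_)
open import Data.Sum using (_⊎_)
open import Relation.Binary.PropositionalEquality using (_≡_; _≢_)
open import Relation.Binary.Bundles using (StrictTotalOrder)
open import Relation.Nullary using (¬_)

-- Items are integer positions (ℤ).  The values f are taken in an
-- arbitrary strict total order (ℝ is not available; only the order of
-- the values is ever used).

-- A banana spanned by a lower end p (a minimum) and an upper end q (a
-- maximum).  Its two trails are stored by their interior nodes, listed
-- from bottom (just above p) to top (just below q).
record Banana : Set where
  constructor banana
  field
    lo     : ℤ
    hi     : ℤ
    inInt  : List ℤ
    midInt : List ℤ
open Banana public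

data Side : Set where
  inS midS : Side

interior : Banana → Side → List ℤ
interior B inS  = inInt B
interior B midS = midInt B

trail : Banana → Side → List ℤ
trail B s = lo B ∷ (interior B s ++ [ hi B ])

data Consec {A : Set} : List A → A → A → Set where
  here  : ∀ {a b xs} → Consec (a ∷ b ∷ xs) a b
  there : ∀ {x xs a b} → Consec xs a b → Consec (x ∷ xs) a b

record BananaTree : Set where
  constructor mkTree
  field
    bananas : List Banana
    root    : ℤ
open BananaTree public

module _ (T : BananaTree) where

  IsMax : ℤ → Set
  IsMax q = ∃[ B ] (B ∈ bananas T × hi B ≡ q)

  IsMin : ℤ → Set
  IsMin p = ∃[ B ] (B ∈ bananas T × lo B ≡ p)

  IsNode : ℤ → Set
  IsNode u = ∃[ B ] ∃[ s ] (B ∈ bananas T × u ∈ trail B s)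

  Up : ℤ → ℤ → Set
  Up q x = ∃[ B ] ∃[ s ] (B ∈ bananas T × q ∈ interior B s × Consec (trail B s) q x)

  Dn : ℤ → ℤ → Set
  Dn q y = ∃[ B ] ∃[ s ] (B ∈ bananas T × q ∈ interior B s × Consec (trail B s) y q)

  In : ℤ → ℤ → Set
  In q x = ∃[ B ] (B ∈ bananas T × hi B ≡ q × Consec (trail B inS) x q)

  Mid : ℤ → ℤ → Set
  Mid q x = ∃[ B ] (B ∈ bananas T × hi B ≡ q × Consec (trail B midS) x q)

  InLeaf : ℤ → ℤ → Set
  InLeaf r x = ∃[ B ] (B ∈ bananas T × lo B ≡ r × Consec (trail B inS) r x)

  MidLeaf : ℤ → ℤ → Set
  MidLeaf r x = ∃[ B ] (B ∈ bananas T × lo B ≡ r × Consec (trail B midS) r x)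

  Birth : ℤ → ℤ → Set
  Birth q p = ∃[ B ] (B ∈ bananas T × hi B ≡ q × lo B ≡ p)

  data UpPath : ℤ → ℤ → Set where
    one  : ∀ {u a} → Up u a → UpPath u a
    step : ∀ {u x a} → Up u x → UpPath x a → UpPath u a

  Ancestor : ℤ → ℤ → Set
  Ancestor a u =
      (IsMax u × UpPath u a)
    ⊎ (IsMin u × ∃[ x ] ((InLeaf u x ⊎ MidLeaf u x) × (x ≡ a ⊎ UpPath x a)))

  Descendant : ℤ → ℤ → Set
  Descendant v d = Ancestor d v

  InSubtree : ℤ → ℤ → Set
  InSubtree q u =
    ∃[ Bq ] (Bq ∈ bananas T × hi Bq ≡ q ×
      ∃[ B ] (B ∈ bananas T ×
        (B ≡ Bq ⊎ ∃[ a ] (a ≢ q × Ancestor a (hi B) × ∃[ s ] (a ∈ trail Bq s))) ×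
        ∃[ s′ ] (u ∈ trail B s′)))

module _ {a ℓ₁ ℓ₂ : Level} (O : StrictTotalOrder a ℓ₁ ℓ₂) where
  open StrictTotalOrder O using () renaming (Carrier to V; _<_ to _<ᵥ_; _≈_ to _≈ᵥ_)

  record IsBananaTree (f : ℤ → V) (T : BananaTree) : Set (a ⊔ ℓ₁ ⊔ ℓ₂) where
    field
      f-distinct    : ∀ u v → IsNode T u → IsNode T v → f u ≈ᵥ f v → u ≡ v
      banana-f      : ∀ B → B ∈ bananas T → f (lo B) <ᵥ f (hi B)
      hi-unique     : ∀ B B′ → B ∈ bananas T → B′ ∈ bananas T → hi B ≡ hi B′ → B ≡ B′
      min≢max       : ∀ B B′ → B ∈ bananas T → B′ ∈ bananas T → lo B ≢ hi B′
      interior-max  : ∀ B s q → B ∈ bananas T → q ∈ interior B s → IsMax T q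
      root-max      : IsMax T (root T)
      root-top      : ∀ B s → B ∈ bananas T → ¬ (root T ∈ interior B s)
      max-interior  : ∀ q → IsMax T q → q ≢ root T →
                      ∃[ B ] ∃[ s ] (B ∈ bananas T × q ∈ interior B s × hi B ≢ q)
      interior-uniq : ∀ q B s B′ s′ → B ∈ bananas T → B′ ∈ bananas T →
                      q ∈ interior B s → q ∈ interior B′ s′ → (B ≡ B′ × s ≡ s′)
      root-end      : (∀ u → IsNode T u → u ≢ root T → u < root T)
                    ⊎ (∀ u → IsNode T u → u ≢ root T → root T < u)

  Invariant3 : (f : ℤ → V) → BananaTree → Set (ℓ₂)
  Invariant3 f T = ∀ q → IsMax T q → q ≢ root T → ∀ x y → Up T q x → Dn T q y →
      (f x >ᵥ f q × f q >ᵥ f y)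
    × (¬ In T x q → (x < q × q < y) ⊎ (y < q × q < x))
    × (In T x q → (x < q × y < q) ⊎ (x > q × y > q))
    where _>ᵥ_ = λ s t → t <ᵥ s

  ConditionIII : (f : ℤ → V) → Banana → Set ℓ₂
  ConditionIII f B =
      (lo B < hi B →
          -- III.1: uᵢ > uᵢ₊₁ for 0 ≤ i ≤ j-2, f(uᵢ) < f(uᵢ₊₁) for 0 ≤ i ≤ j-1
          (Linked _>_ (lo B ∷ inInt B) × Linked (λ s t → f s <ᵥ f t) (trail B inS))
        × (Linked _<_ (trail B midS) × Linked (λ s t → f s <ᵥ f t) (trail B midS)))
    × (hi B < lo B →
          (Linked _<_ (lo B ∷ inInt B) × Linked (λ s t → f s <ᵥ f t) (trail B inS))
        × (Linked _>_ (trail B midS) × Linked (λ s t → f s <ᵥ f t) (trail B midS)))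

Invariant1 : BananaTree → Set
Invariant1 T = ∀ q → IsMax T q → q ≢ root T → ∀ p → Birth T q p →
    (p < q → (∀ u → u ≢ q → InSubtree T q u → u < q)
           × (∀ d → Dn T q d → ∀ v → (v ≡ d ⊎ Descendant T v d) → v > q))
  × (q < p → (∀ u → u ≢ q → InSubtree T q u → u > q)
           × (∀ d → Dn T q d → ∀ v → (v ≡ d ⊎ Descendant T v d) → v < q))

-- Let the banana be spanned by p and q.  Every interior node v of one of its
-- trails is a maximum other than the root, so Invariant 3 applies at v, with
-- up(v) and dn(v) its two neighbours on the trail.  Part (1) makes f increase
-- along the trail.  On the mid-trail v is never in(up(v)), so by part (2)
-- every interior node lies strictly between its neighbours; such a sequence is
-- monotone, in the direction from p to q.  On the in-trail the same holds up
-- to the last interior node u, which is in(q): by part (3) its lower neighbour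
-- lies on the same side of u as q, and Invariant 1 (or, if q is the special
-- root, the root being at one end of the sequence) puts u on the side of q
-- where p lies.  Propagating this last step backwards through the monotone
-- triples gives Condition III.1.
module Submission where

open import Defs
open import Level using (Level)
open import Data.Integer using (ℤ; _<_; _>_)
import Data.Integer.Properties as ℤ
open import Data.List using (List; []; _∷_; _++_; [_])
open import Data.List.Membership.Propositional using (_∈_)
open import Data.List.Membership.Propositional.Properties using (∈-++⁻; ∈-++⁺ˡ)
open import Data.List.Relation.Unary.Any using (here; there)
open import Data.List.Relation.Unary.Linked using (Linked; []; [-]; _∷_; head)
open import Data.Product using (_×_; _,_; proj₁; proj₂)
import Data.Product as Product
open import Data.Sum using (_⊎_; inj₁; inj₂)
import Data.Sum as Sum
open import Data.Unit using (⊤; tt)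
open import Data.Empty using (⊥-elim)
open import Function using (flip)
open import Relation.Binary.Bundles using (StrictTotalOrder)
open import Relation.Binary.Definitions using (Transitive; Asymmetric; tri<; tri≈; tri>)
open import Relation.Binary.PropositionalEquality using (_≡_; _≢_; refl; sym; trans; subst)
open import Relation.Nullary using (¬_; yes; no)

module _ {A : Set} where

  Between : (A → A → Set) → A → A → A → Set
  Between _≺_ a b c = (a ≺ b × b ≺ c) ⊎ (c ≺ b × b ≺ a)

  between-sym : ∀ {R a b c} → Between R a b c → Between R c b a
  between-sym = Sum.swap

  between-flip : ∀ {R a b c} → Between R a b c → Between (flip R) a b c
  between-flip (inj₁ (Rab , Rbc)) = inj₂ (Rbc , Rab)
  between-flip (inj₂ (Rcb , Rba)) = inj₁ (Rba , Rcb)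

  Linked₃ : (A → A → A → Set) → List A → Set
  Linked₃ P (x ∷ y ∷ z ∷ xs) = P x y z × Linked₃ P (y ∷ z ∷ xs)
  Linked₃ P _                = ⊤

  linked₃-map : ∀ {P Q : A → A → A → Set} → (∀ {a b c} → P a b c → Q a b c) →
                ∀ xs → Linked₃ P xs → Linked₃ Q xs
  linked₃-map P⇒Q []               _            = tt
  linked₃-map P⇒Q (_ ∷ [])         _            = tt
  linked₃-map P⇒Q (_ ∷ _ ∷ [])     _            = tt
  linked₃-map P⇒Q (_ ∷ y ∷ z ∷ xs) (Pxyz , P₃) =
    P⇒Q Pxyz , linked₃-map P⇒Q (y ∷ z ∷ xs) P₃

  LastLink : (A → A → Set) → List A → Set
  LastLink R (x ∷ y ∷ [])     = R x y
  LastLink R (x ∷ y ∷ z ∷ xs) = LastLink R (y ∷ z ∷ xs)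
  LastLink R _                = ⊤

  consec-∈ˡ : ∀ {xs : List A} {a b} → Consec xs a b → a ∈ xs
  consec-∈ˡ here      = here refl
  consec-∈ˡ (there c) = there (consec-∈ˡ c)

  -- The hypotheses below carry `b ∈ J` because `Consec` locates entries by
  -- value: a consecutive pair ending in b does not by itself make b interior.

  linked-interior : ∀ {ℓ} {R : A → A → Set ℓ} y J h →
    (∀ {a b c} → Consec (y ∷ J ++ [ h ]) a b → Consec (y ∷ J ++ [ h ]) b c →
                 b ∈ J → R a b × R b c) →
    (J ≡ [] → R y h) → Linked R (y ∷ J ++ [ h ])
  linked-interior y []              h _     Ryh = Ryh refl ∷ [-]
  linked-interior y (q ∷ [])        h inner _   with inner here (there here) (here refl)
  ... | Ryq , Rqh = Ryq ∷ Rqh ∷ [-]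
  linked-interior y (q ∷ J@(_ ∷ _)) h inner _   =
    proj₁ (inner here (there here) (here refl)) ∷
    linked-interior q J h (λ ab bc b∈ → inner (there ab) (there bc) (there b∈)) (λ ())

  linked₃-interior : ∀ {P : A → A → A → Set} y J h →
    (∀ {a b c} → Consec (y ∷ J ++ [ h ]) a b → Consec (y ∷ J ++ [ h ]) b c →
                 b ∈ J → P a b c) →
    Linked₃ P (y ∷ J ++ [ h ])
  linked₃-interior y []              h _     = tt
  linked₃-interior y (q ∷ [])        h inner = inner here (there here) (here refl) , tt
  linked₃-interior y (q ∷ J@(_ ∷ _)) h inner =
    inner here (there here) (here refl) ,
    linked₃-interior q J h (λ ab bc b∈ → inner (there ab) (there bc) (there b∈))

  linked₃-prefix : ∀ {P : A → A → A → Set} y J h →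
    (∀ {a b c} → Consec (y ∷ J ++ [ h ]) a b → Consec (y ∷ J ++ [ h ]) b c →
                 b ∈ J → c ∈ J → P a b c) →
    Linked₃ P (y ∷ J)
  linked₃-prefix y []              h _     = tt
  linked₃-prefix y (q ∷ [])        h _     = tt
  linked₃-prefix y (q ∷ J@(_ ∷ _)) h inner =
    inner here (there here) (here refl) (there (here refl)) ,
    linked₃-prefix q J h (λ ab bc b∈ c∈ → inner (there ab) (there bc) (there b∈) (there c∈))

  lastLink-prefix : ∀ {R : A → A → Set} y J h →
    (∀ {a b} → Consec (y ∷ J ++ [ h ]) a b → Consec (y ∷ J ++ [ h ]) b h → b ∈ J → R a b) →
    LastLink R (y ∷ J)
  lastLink-prefix y []              h _    = tt
  lastLink-prefix y (q ∷ [])        h last = last here (there here) (here refl)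
  lastLink-prefix y (q ∷ J@(_ ∷ _)) h last =
    lastLink-prefix q J h (λ ab bh b∈ → last (there ab) (there bh) (there b∈))

module _ {A : Set} {_≺_ : A → A → Set} (≺-asym : Asymmetric _≺_) where

  between-forward : ∀ {x y z} → Between _≺_ x y z → x ≺ y → y ≺ z
  between-forward (inj₁ (_ , y≺z)) _   = y≺z
  between-forward (inj₂ (_ , y≺x)) x≺y = ⊥-elim (≺-asym x≺y y≺x)

  between-backward : ∀ {x y z} → Between _≺_ x y z → y ≺ z → x ≺ y
  between-backward (inj₁ (x≺y , _)) _   = x≺y
  between-backward (inj₂ (z≺y , _)) y≺z = ⊥-elim (≺-asym y≺z z≺y)

  linked-forward : ∀ {x y} zs → Linked₃ (Between _≺_) (x ∷ y ∷ zs) → x ≺ y →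
                   Linked _≺_ (x ∷ y ∷ zs)
  linked-forward []       _           x≺y = x≺y ∷ [-]
  linked-forward (_ ∷ zs) (bxyz , b₃) x≺y =
    x≺y ∷ linked-forward zs b₃ (between-forward bxyz x≺y)

  linked-backward : ∀ xs → Linked₃ (Between _≺_) xs → LastLink _≺_ xs → Linked _≺_ xs
  linked-backward []               _           _    = []
  linked-backward (_ ∷ [])         _           _    = [-]
  linked-backward (_ ∷ _ ∷ [])     _           x≺y  = x≺y ∷ [-]
  linked-backward (_ ∷ y ∷ z ∷ xs) (bxyz , b₃) last with linked-backward (y ∷ z ∷ xs) b₃ last
  ... | rest = between-backward bxyz (head rest) ∷ rest

module _ {A : Set} {_≺_ : A → A → Set} (≺-trans : Transitive _≺_) where

  linked-first-last : ∀ {x z} ys → Linked _≺_ (x ∷ ys ++ [ z ]) → x ≺ z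
  linked-first-last []       (x≺z ∷ _)    = x≺z
  linked-first-last (_ ∷ ys) (x≺y ∷ rest) = ≺-trans x≺y (linked-first-last ys rest)

module _ {A : Set} {_≺_ : A → A → Set} (≺-trans : Transitive _≺_) (≺-asym : Asymmetric _≺_) where

  linked-by-ends : ∀ {x z} ys → Linked₃ (Between _≺_) (x ∷ ys ++ [ z ]) →
                   (∀ {y} → y ∈ ys → x ≺ y ⊎ y ≺ x) → x ≺ z →
                   Linked _≺_ (x ∷ ys ++ [ z ])
  linked-by-ends                 []       _  _   x≺z = x≺z ∷ [-]
  linked-by-ends {x = x} {z = z} (y ∷ ys) b₃ cmp x≺z with cmp (here refl)
  ... | inj₁ x≺y = linked-forward ≺-asym (ys ++ [ z ]) b₃ x≺y
  ... | inj₂ y≺x = ⊥-elim (≺-asym x≺z (linked-first-last (flip ≺-trans) (y ∷ ys) decreasing))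
    where
      decreasing : Linked (flip _≺_) (x ∷ y ∷ ys ++ [ z ])
      decreasing = linked-forward ≺-asym (ys ++ [ z ])
        (linked₃-map (between-flip {R = _≺_}) (x ∷ y ∷ ys ++ [ z ]) b₃) y≺x

module Trails {a ℓ₁ ℓ₂ : Level} (O : StrictTotalOrder a ℓ₁ ℓ₂)
  (f : ℤ → StrictTotalOrder.Carrier O) {T : BananaTree}
  (bt : IsBananaTree O f T) (inv1 : Invariant1 T) (inv3 : Invariant3 O f T)
  {B : Banana} (B∈ : B ∈ bananas T) where

  open StrictTotalOrder O using (irrefl; module Eq) renaming (_<_ to _<ᵥ_)
  open IsBananaTree bt

  f-irrefl : ∀ {u v} → f u <ᵥ f v → u ≢ v
  f-irrefl fu<fv refl = irrefl Eq.refl fu<fv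

  interior∈trail : ∀ {s q} → q ∈ interior B s → q ∈ trail B s
  interior∈trail q∈ = there (∈-++⁺ˡ q∈)

  lo≢hi : lo B ≢ hi B
  lo≢hi = min≢max B B B∈ B∈

  lo≢interior : ∀ {B′ s q} → B′ ∈ bananas T → q ∈ interior B s → lo B′ ≢ q
  lo≢interior {s = s} {q} B′∈ q∈ lo≡q with interior-max B s q B∈ q∈
  ... | B″ , B″∈ , hi≡q = min≢max _ B″ B′∈ B″∈ (trans lo≡q (sym hi≡q))

  interior≢root : ∀ {s q} → q ∈ interior B s → q ≢ root T
  interior≢root {s} q∈ refl = root-top B s B∈ q∈

  interior≢hi : ∀ {s q} → q ∈ interior B s → q ≢ hi B
  interior≢hi {s} {q} q∈ q≡hi with max-interior q (B , B∈ , sym q≡hi) (interior≢root {s} q∈)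
  ... | B′ , s′ , B′∈ , q∈′ , hi′≢q with interior-uniq q B s B′ s′ B∈ B′∈ q∈ q∈′
  ...   | refl , _ = hi′≢q (sym q≡hi)

  lo-comparable : ∀ {s q} → q ∈ interior B s → lo B < q ⊎ q < lo B
  lo-comparable {s} {q} q∈ with ℤ.<-cmp (lo B) q
  ... | tri< lo<q _ _ = inj₁ lo<q
  ... | tri≈ _ lo≡q _ = ⊥-elim (lo≢interior {s = s} B∈ q∈ lo≡q)
  ... | tri> _ _ q<lo = inj₂ q<lo

  inv3-on-trail : ∀ {s y q x} → q ∈ interior B s →
      Consec (trail B s) y q → Consec (trail B s) q x →
      (f q <ᵥ f x × f y <ᵥ f q)
    × (¬ In T x q → Between _<_ x q y)
    × (In T x q → (x < q × y < q) ⊎ (x > q × y > q))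
  inv3-on-trail {s} {y} {q} {x} q∈ yq qx =
    inv3 q (interior-max B s q B∈ q∈) (interior≢root {s} q∈) x y
      (B , s , B∈ , q∈ , qx) (B , s , B∈ , q∈ , yq)

  in⇒on-in-trail : ∀ {s y q x} → q ∈ interior B s →
      Consec (trail B s) y q → Consec (trail B s) q x → In T x q → s ≡ inS × hi B ≡ x
  in⇒on-in-trail {s} {q = q} q∈ yq qx (B′ , B′∈ , hi′≡x , qx′)
    with interior-uniq q B s B′ inS B∈ B′∈ q∈ q∈in′
    where
      q∈in′ : q ∈ inInt B′
      q∈in′ with consec-∈ˡ qx′
      ... | here q≡lo = ⊥-elim (lo≢interior {s = s} B′∈ q∈ (sym q≡lo))
      ... | there q∈′ with ∈-++⁻ (inInt B′) q∈′
      ...   | inj₁ q∈in        = q∈in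
      ...   | inj₂ (here q≡hi) =
        ⊥-elim (f-irrefl (proj₁ (proj₁ (inv3-on-trail {s} q∈ yq qx))) (trans q≡hi hi′≡x))
  ... | refl , refl = refl , hi′≡x

  trail-in-subtree : ∀ {s u} → u ∈ trail B s → InSubtree T (hi B) u
  trail-in-subtree {s} u∈ = B , B∈ , refl , B , B∈ , inj₁ refl , s , u∈

  below-hi : ∀ {s u} → lo B < hi B → u ∈ trail B s → u ≢ hi B → u < hi B
  below-hi {s} {u} lo<hi u∈ u≢hi with hi B ℤ.≟ root T | root-end
  ... | no hi≢root | _ =
    proj₁ (proj₁ (inv1 (hi B) (B , B∈ , refl) hi≢root (lo B) (B , B∈ , refl , refl)) lo<hi)
      u u≢hi (trail-in-subtree {s} u∈)
  ... | yes hi≡root | inj₁ below-root =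
    subst (u <_) (sym hi≡root) (below-root u (B , s , B∈ , u∈) (subst (u ≢_) hi≡root u≢hi))
  ... | yes hi≡root | inj₂ above-root =
    ⊥-elim (ℤ.<-asym lo<hi (subst (_< lo B) (sym hi≡root)
      (above-root (lo B) (B , inS , B∈ , here refl) (subst (lo B ≢_) hi≡root lo≢hi))))

  above-hi : ∀ {s u} → hi B < lo B → u ∈ trail B s → u ≢ hi B → hi B < u
  above-hi {s} {u} hi<lo u∈ u≢hi with hi B ℤ.≟ root T | root-end
  ... | no hi≢root | _ =
    proj₁ (proj₂ (inv1 (hi B) (B , B∈ , refl) hi≢root (lo B) (B , B∈ , refl , refl)) hi<lo)
      u u≢hi (trail-in-subtree {s} u∈)
  ... | yes hi≡root | inj₁ below-root =
    ⊥-elim (ℤ.<-asym hi<lo (subst (lo B <_) (sym hi≡root)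
      (below-root (lo B) (B , inS , B∈ , here refl) (subst (lo B ≢_) hi≡root lo≢hi))))
  ... | yes hi≡root | inj₂ above-root =
    subst (_< u) (sym hi≡root) (above-root u (B , s , B∈ , u∈) (subst (u ≢_) hi≡root u≢hi))

  f-increasing : ∀ s → Linked (λ u v → f u <ᵥ f v) (trail B s)
  f-increasing s = linked-interior (lo B) (interior B s) (hi B)
    (λ ab bc b∈ → Product.swap (proj₁ (inv3-on-trail {s} b∈ ab bc))) (λ _ → banana-f B B∈)

  mid-between : Linked₃ (Between _<_) (trail B midS)
  mid-between = linked₃-interior (lo B) (midInt B) (hi B) λ ab bc b∈ →
    between-sym {R = _<_} (proj₁ (proj₂ (inv3-on-trail {midS} b∈ ab bc)) λ b-in-c →
      midS≢inS (proj₁ (in⇒on-in-trail {midS} b∈ ab bc b-in-c)))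
    where
      midS≢inS : midS ≢ inS
      midS≢inS ()

  mid-increasing : lo B < hi B → Linked _<_ (trail B midS)
  mid-increasing =
    linked-by-ends ℤ.<-trans ℤ.<-asym (midInt B) mid-between (lo-comparable {midS})

  mid-decreasing : hi B < lo B → Linked _>_ (trail B midS)
  mid-decreasing = linked-by-ends (flip ℤ.<-trans) ℤ.<-asym (midInt B)
    (linked₃-map (between-flip {R = _<_}) (trail B midS) mid-between)
    (λ q∈ → Sum.swap (lo-comparable {midS} q∈))

  in-between : Linked₃ (Between _<_) (lo B ∷ inInt B)
  in-between = linked₃-prefix (lo B) (inInt B) (hi B) λ ab bc b∈ c∈ →
    between-sym {R = _<_} (proj₁ (proj₂ (inv3-on-trail {inS} b∈ ab bc)) λ b-in-c →
      interior≢hi {inS} c∈ (sym (proj₂ (in⇒on-in-trail {inS} b∈ ab bc b-in-c))))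

  in-last-step : ∀ {a b} → Consec (trail B inS) a b → Consec (trail B inS) b (hi B) →
                 b ∈ inInt B → (hi B < b × a < b) ⊎ (b < hi B × b < a)
  in-last-step ab b-hi b∈ =
    proj₂ (proj₂ (inv3-on-trail {inS} b∈ ab b-hi)) (B , B∈ , refl , b-hi)

  in-decreasing : lo B < hi B → Linked _>_ (lo B ∷ inInt B)
  in-decreasing lo<hi = linked-backward ℤ.<-asym (lo B ∷ inInt B)
    (linked₃-map (between-flip {R = _<_}) (lo B ∷ inInt B) in-between)
    (lastLink-prefix (lo B) (inInt B) (hi B) last-step)
    where
      last-step : ∀ {a b} → Consec (trail B inS) a b → Consec (trail B inS) b (hi B) →
                  b ∈ inInt B → a > b
      last-step ab b-hi b∈ with in-last-step ab b-hi b∈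
      ... | inj₂ (_ , b<a)  = b<a
      ... | inj₁ (hi<b , _) = ⊥-elim (ℤ.<-asym hi<b
        (below-hi {inS} lo<hi (interior∈trail {inS} b∈) (interior≢hi {inS} b∈)))

  in-increasing : hi B < lo B → Linked _<_ (lo B ∷ inInt B)
  in-increasing hi<lo = linked-backward ℤ.<-asym (lo B ∷ inInt B) in-between
    (lastLink-prefix (lo B) (inInt B) (hi B) last-step)
    where
      last-step : ∀ {a b} → Consec (trail B inS) a b → Consec (trail B inS) b (hi B) →
                  b ∈ inInt B → a < b
      last-step ab b-hi b∈ with in-last-step ab b-hi b∈
      ... | inj₁ (_ , a<b)  = a<b
      ... | inj₂ (b<hi , _) = ⊥-elim (ℤ.<-asym b<hi
        (above-hi {inS} hi<lo (interior∈trail {inS} b∈) (interior≢hi {inS} b∈)))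

lemmaA3 : ∀ {a ℓ₁ ℓ₂ : Level} (O : StrictTotalOrder a ℓ₁ ℓ₂)
            (f : ℤ → StrictTotalOrder.Carrier O) (T : BananaTree) →
            IsBananaTree O f T → Invariant1 T → Invariant3 O f T →
            ∀ B → B ∈ bananas T → ConditionIII O f B
lemmaA3 O f T bt inv1 inv3 B B∈ =
    (λ lo<hi → (in-decreasing lo<hi , f-increasing inS) , (mid-increasing lo<hi , f-increasing midS))
  , (λ hi<lo → (in-increasing hi<lo , f-increasing inS) , (mid-decreasing hi<lo , f-increasing midS))
  where open Trails O f bt inv1 inv3 B∈
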